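{- Let $s,m$ be positive integers and let $S,S'\in\mathbb D_m(s)$ with $t(S)=t(S')=t$. Write $a_k,n_k$ for the quantities of $S$ and $a'_k,n'_k$ for those of $S'$. Assume there exist integers $1\le i<j$ such that: (1) $(n'_i,a'_i)=(n_i-1,a_i-1)$ or $(n'_i,a'_i)=(n_i,a_i-1)$; (2) $(n'_j,a'_j)=(n_j+1,a_j+1)$ or $(n'_j,a'_j)=(n_j,a_j+1)$; (3) $(n_k,a_k)=(n'_k,a'_k)$ for all $1\le k\le tm$ with $k\ne i,j$. Then $f(S)<f(S')$.
   Context: For a finite set $S$ of integers, $f(S)=\sum_{x\in S}x-\frac{|S|(|S|-1)}{2}$. Let $N=\lceil (s-1)/2\rceil m$. For a nonempty set $S\subseteq\{1,\dots,Ns-1\}$ let $t(S)=\min\{i\ge1: S\subseteq[0,ims-1]\}$, and for $1\le i\le N$ let $\mathcal B_i=S\cap[(i-1)s,is-1]$, $a_i=|\mathcal B_i|$, and $n_i=\max\{x\bmod s: x\in\mathcal B_i\}$ ($n_i=0$ if $\mathcal B_i=\emptyset$). $\mathbb D_m(s)$ denotes the set of all nonempty $S\subseteq\{1,\dots,Ns-1\}$ such that, for each $1\le i\le N$, $\mathcal B_i$ is a (possibly empty) set of consecutive integers. -}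

module Defs where

open import Data.Nat using (ℕ; zero; suc; _+_; _*_; _∸_; _≤_; _<_; _⊔_; _≤?_; _<?_; NonZero)
open import Data.Nat.DivMod using (_/_; _%_)
open import Data.Integer as ℤ using (ℤ; +_)
open import Data.List using (List; []; length; filter; map; foldr)
open import Data.Nat.ListAction using (sum)
open import Data.List.Relation.Unary.All using (All)
open import Data.List.Relation.Unary.Unique.Propositional using (Unique)
open import Data.List.Membership.Propositional using (_∈_)
open import Data.Product using (_×_)
open import Relation.Nullary using (¬_)
open import Relation.Nullary.Decidable using (_×-dec_)
open import Relation.Binary.PropositionalEquality using (_≡_)

-- A finite set of integers (here: naturals, since S ⊆ {1,…,Ns-1})
-- is represented by a duplicate-free list.

-- f(S) = Σ_{x∈S} x − |S|(|S|−1)/2   (the division is exact)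
f : List ℕ → ℤ
f S = (+ sum S) ℤ.- (+ ((length S * (length S ∸ 1)) / 2))

-- N = ⌈(s−1)/2⌉ · m   (for s ≥ 1, ⌈(s−1)/2⌉ = ((s−1)+1) div 2)
N : ℕ → ℕ → ℕ
N m s = (((s ∸ 1) + 1) / 2) * m

block : ℕ → List ℕ → ℕ → List ℕ
block s S i = filter (λ x → ((i ∸ 1) * s ≤? x) ×-dec (x <? i * s)) S

aq : ℕ → List ℕ → ℕ → ℕ
aq s S i = length (block s S i)

nq : (s : ℕ) → .{{_ : NonZero s}} → List ℕ → ℕ → ℕ
nq s S i = foldr _⊔_ 0 (map (λ x → x % s) (block s S i))

InD : ℕ → ℕ → List ℕ → Set
InD m s S =
  Unique S × ¬ (S ≡ []) × All (λ x → 1 ≤ x × x < N m s * s) S ×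
  (∀ i → 1 ≤ i → i ≤ N m s →
     ∀ x y z → x ∈ S → z ∈ S → (i ∸ 1) * s ≤ x → z < i * s →
     x ≤ y → y ≤ z → y ∈ S)

IsT : ℕ → ℕ → List ℕ → ℕ → Set
IsT m s S t =
  1 ≤ t × All (λ x → x < t * m * s) S ×
  (∀ i → 1 ≤ i → All (λ x → x < i * m * s) S → t ≤ i)

-- Every block 𝓑_k of a set in 𝔻_m(s) is a run of consecutive integers ending at (k−1)s + n_k,
-- so its size and its sum are determined by (n_k, a_k). Passing from S to S′ removes an end
-- element e < is of 𝓑_i and adds an end element e′ ≥ (j−1)s to 𝓑_j, leaving all other blocks
-- unchanged. Hence |S| = |S′| and Σ S′ = Σ S + e′ − e > Σ S, so f(S) < f(S′).
module Submission where

open import Data.Empty using (⊥-elim)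
import Data.Integer as ℤ
import Data.Integer.Properties as ℤ
open import Data.List using (List; []; _∷_; length; _++_; filter; foldr)
open import Data.List.Extrema.Nat using (min; min≤xs; min≤⊤; argmin-sel)
open import Data.List.Membership.Propositional using (_∈_)
open import Data.List.Membership.Propositional.Properties
  using (∈-filter⁻; ∈-filter⁺; ∈-map⁻; ∈-map⁺; foldr-selective)
open import Data.List.Membership.Propositional.Properties.WithK using (unique∧set⇒bag)
open import Data.List.Properties
  using (length-++; foldr-forcesᵇ; foldr-preservesᵇ; filter-accept; filter-reject; filter-none; filter-all)
open import Data.List.Relation.Binary.BagAndSetEquality using (∼bag⇒↭)
open import Data.List.Relation.Binary.Permutation.Propositional using (_↭_; ↭-refl; ↭-prep; ↭-trans; ↭-sym)
open import Data.List.Relation.Binary.Permutation.Propositional.Properties using (↭-length; shift)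
open import Data.List.Relation.Unary.All as All using (All)
import Data.List.Relation.Unary.All.Properties as All
import Data.List.Relation.Unary.AllPairs as AllPairs
open import Data.List.Relation.Unary.Any using (here; there)
open import Data.List.Relation.Unary.Unique.Propositional using (Unique)
import Data.List.Relation.Unary.Unique.Propositional.Properties as Unique
open import Data.Nat
open import Data.Nat.DivMod using (_/_; _%_; [m+kn]%n≡m%n; m<n⇒m%n≡m; m%n<n)
open import Data.Nat.ListAction using (sum)
open import Data.Nat.ListAction.Properties using (sum-↭; sum-++)
open import Data.Nat.Properties
open import Algebra.Properties.CommutativeSemigroup +-commutativeSemigroup using (xy∙z≈xz∙y)
open import Data.Product using (∃; _×_; _,_; proj₁; proj₂)
import Data.Product as Prod
open import Data.Sum using (_⊎_; inj₁; inj₂)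
import Data.Sum as Sum
open import Function using (_∘_)
open import Function.Bundles using (mk⇔)
open import Relation.Binary.PropositionalEquality
open import Relation.Nullary using (Dec; yes; no)
open import Relation.Nullary.Decidable using (_×-dec_)

open import Defs

interval : ℕ → ℕ → List ℕ
interval lo zero    = []
interval lo (suc a) = lo ∷ interval (suc lo) a

length-interval : ∀ lo a → length (interval lo a) ≡ a
length-interval lo zero    = refl
length-interval lo (suc a) = cong suc (length-interval (suc lo) a)

∈-interval⁻ : ∀ lo a {y} → y ∈ interval lo a → lo ≤ y × y < lo + a
∈-interval⁻ lo (suc a) (here refl) = ≤-refl , m<m+n lo z<s
∈-interval⁻ lo (suc a) {y} (there y∈) with ∈-interval⁻ (suc lo) a y∈
... | lo<y , y<1+lo+a = <⇒≤ lo<y , subst (y <_) (sym (+-suc lo a)) y<1+lo+a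

∈-interval⁺ : ∀ lo a {y} → lo ≤ y → y < lo + a → y ∈ interval lo a
∈-interval⁺ lo zero    {y} lo≤y y<lo+0 = ⊥-elim (<⇒≱ (subst (y <_) (+-identityʳ lo) y<lo+0) lo≤y)
∈-interval⁺ lo (suc a) {y} lo≤y y<lo+1+a with m≤n⇒m<n∨m≡n lo≤y
... | inj₂ refl = here refl
... | inj₁ lo<y = there (∈-interval⁺ (suc lo) a lo<y (subst (y <_) (+-suc lo a) y<lo+1+a))

interval-unique : ∀ lo a → Unique (interval lo a)
interval-unique lo zero    = AllPairs.[]
interval-unique lo (suc a) =
  All.tabulate (λ y∈ lo≡y → <-irrefl lo≡y (proj₁ (∈-interval⁻ (suc lo) a y∈)))
  AllPairs.∷ interval-unique (suc lo) a

sum-interval-∷ʳ : ∀ lo a → sum (interval lo (suc a)) ≡ sum (interval lo a) + (lo + a)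
sum-interval-∷ʳ lo zero    = refl
sum-interval-∷ʳ lo (suc a) = begin
  lo + sum (interval (suc lo) (suc a))            ≡⟨ cong (lo +_) (sum-interval-∷ʳ (suc lo) a) ⟩
  lo + (sum (interval (suc lo) a) + suc (lo + a)) ≡⟨ +-assoc lo _ _ ⟨
  lo + sum (interval (suc lo) a) + suc (lo + a)   ≡⟨ cong (lo + sum (interval (suc lo) a) +_) (+-suc lo a) ⟨
  lo + sum (interval (suc lo) a) + (lo + suc a)   ∎
  where open ≡-Reasoning

Convex : List ℕ → Set
Convex L = ∀ {x y z} → x ∈ L → z ∈ L → x ≤ y → y ≤ z → y ∈ L

convex⇒↭interval : ∀ {L M} → Unique L → Convex L → M ∈ L → All (_≤ M) L →
  ∃ λ lo → lo ∈ L × lo + length L ≡ suc M × L ↭ interval lo (length L)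
convex⇒↭interval {L} {M} L! convex M∈L L≤M = lo , lo∈L , lo+|L|≡1+M , L↭
  where
  lo = min M L
  lo∈L : lo ∈ L
  lo∈L with argmin-sel (λ x → x) M L
  ... | inj₁ lo≡M = subst (_∈ L) (sym lo≡M) M∈L
  ... | inj₂ lo∈  = lo∈
  d = suc M ∸ lo
  lo+d≡1+M : lo + d ≡ suc M
  lo+d≡1+M = m+[n∸m]≡n (m≤n⇒m≤1+n (min≤⊤ M L))
  L↭d : L ↭ interval lo d
  L↭d = ∼bag⇒↭ (unique∧set⇒bag L! (interval-unique lo d) (mk⇔ to from))
    where
    to : ∀ {x} → x ∈ L → x ∈ interval lo d
    to {x} x∈L = ∈-interval⁺ lo d (All.lookup (min≤xs M L) x∈L)
                   (subst (x <_) (sym lo+d≡1+M) (s≤s (All.lookup L≤M x∈L)))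
    from : ∀ {x} → x ∈ interval lo d → x ∈ L
    from {x} x∈ with ∈-interval⁻ lo d x∈
    ... | lo≤x , x<lo+d = convex lo∈L M∈L lo≤x (≤-pred (subst (x <_) lo+d≡1+M x<lo+d))
  |L|≡d : length L ≡ d
  |L|≡d = trans (↭-length L↭d) (length-interval lo d)
  lo+|L|≡1+M : lo + length L ≡ suc M
  lo+|L|≡1+M = trans (cong (lo +_) |L|≡d) lo+d≡1+M
  L↭ : L ↭ interval lo (length L)
  L↭ = subst (λ a → L ↭ interval lo a) (sym |L|≡d) L↭d

-- Deleting the top (first case) or the bottom element of the interval [lo, top] of length a + 1.
interval-shrink : ∀ {lo lo′ a top top′} → lo + suc a ≡ suc top → lo′ + a ≡ suc top′ →
  suc top′ ≡ top ⊎ top′ ≡ top →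
  ∃ λ e → lo ≤ e × e ≤ top × sum (interval lo (suc a)) ≡ sum (interval lo′ a) + e
interval-shrink {lo} {lo′} {a} lo+1+a≡1+top =
  shrink (suc-injective (trans (sym (+-suc lo a)) lo+1+a≡1+top))
  where
  shrink : ∀ {top top′} → lo + a ≡ top → lo′ + a ≡ suc top′ → suc top′ ≡ top ⊎ top′ ≡ top →
    ∃ λ e → lo ≤ e × e ≤ top × sum (interval lo (suc a)) ≡ sum (interval lo′ a) + e
  shrink lo+a≡top lo′+a≡1+top′ (inj₁ refl) =
    lo + a , m≤m+n lo a , ≤-reflexive lo+a≡top ,
    trans (sum-interval-∷ʳ lo a) (cong (λ l → sum (interval l a) + (lo + a)) lo≡lo′)
    where
    lo≡lo′ : lo ≡ lo′
    lo≡lo′ = +-cancelʳ-≡ a lo lo′ (trans lo+a≡top (sym lo′+a≡1+top′))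
  shrink lo+a≡top lo′+a≡1+top′ (inj₂ refl) =
    lo , ≤-refl , ≤-trans (m≤m+n lo a) (≤-reflexive lo+a≡top) ,
    trans (+-comm lo _) (cong (λ l → sum (interval l a) + lo) 1+lo≡lo′)
    where
    1+lo≡lo′ : suc lo ≡ lo′
    1+lo≡lo′ = +-cancelʳ-≡ a (suc lo) lo′ (trans (cong suc lo+a≡top) (sym lo′+a≡1+top′))

empty-or-inhabited : ∀ {A : Set} (xs : List A) → xs ≡ [] ⊎ ∃ (_∈ xs)
empty-or-inhabited []      = inj₁ refl
empty-or-inhabited (x ∷ _) = inj₂ (x , here refl)

inhabited-of-length : ∀ {A : Set} {xs : List A} {n} → length xs ≡ suc n → ∃ (_∈ xs)
inhabited-of-length {xs = x ∷ _} _ = x , here refl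

≤-foldr-⊔ : ∀ {x xs} → x ∈ xs → x ≤ foldr _⊔_ 0 xs
≤-foldr-⊔ {xs = xs} =
  All.lookup (foldr-forcesᵇ (λ m n m⊔n≤o → m⊔n≤o⇒m≤o m n m⊔n≤o , m⊔n≤o⇒n≤o m n m⊔n≤o) 0 xs ≤-refl)

foldr-⊔-∈ : ∀ {x xs} → x ∈ xs → foldr _⊔_ 0 xs ∈ xs
foldr-⊔-∈ {x} {xs} x∈xs with foldr-selective ⊔-sel 0 xs
... | inj₂ max∈xs = max∈xs
... | inj₁ max≡0  = subst (_∈ xs) (trans x≡0 (sym max≡0)) x∈xs
  where
  x≡0 : x ≡ 0
  x≡0 = n≤0⇒n≡0 (subst (x ≤_) max≡0 (≤-foldr-⊔ x∈xs))

foldr-⊔-< : ∀ {b xs} → 0 < b → All (_< b) xs → foldr _⊔_ 0 xs < b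
foldr-⊔-< = foldr-preservesᵇ ⊔-lub

sumTo : (ℕ → ℕ) → ℕ → ℕ
sumTo f zero    = 0
sumTo f (suc K) = sumTo f K + f (suc K)

sumTo-cong : ∀ {f g} K → (∀ k → 1 ≤ k → k ≤ K → f k ≡ g k) → sumTo f K ≡ sumTo g K
sumTo-cong zero    f≗g = refl
sumTo-cong (suc K) f≗g =
  cong₂ _+_ (sumTo-cong K (λ k 1≤k k≤K → f≗g k 1≤k (m≤n⇒m≤1+n k≤K))) (f≗g (suc K) (s≤s z≤n) ≤-refl)

sumTo-bump : ∀ {f g i e} K → 1 ≤ i → i ≤ K → (∀ k → 1 ≤ k → k ≤ K → k ≢ i → f k ≡ g k) →
  f i ≡ g i + e → sumTo f K ≡ sumTo g K + e
sumTo-bump zero (s≤s _) () _ _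
sumTo-bump {f} {g} {i} {e} (suc K) 1≤i i≤1+K f≗g fi≡gi+e with i ≟ suc K
... | yes refl = begin
  sumTo f K + f i       ≡⟨ cong₂ _+_ (sumTo-cong K f≗g′) fi≡gi+e ⟩
  sumTo g K + (g i + e) ≡⟨ +-assoc (sumTo g K) (g i) e ⟨
  sumTo g K + g i + e   ∎
  where
  open ≡-Reasoning
  f≗g′ : ∀ k → 1 ≤ k → k ≤ K → f k ≡ g k
  f≗g′ k 1≤k k≤K = f≗g k 1≤k (m≤n⇒m≤1+n k≤K) (<⇒≢ (s≤s k≤K))
... | no i≢1+K = begin
  sumTo f K + f (suc K)     ≡⟨ cong₂ _+_ (sumTo-bump K 1≤i i≤K f≗g′ fi≡gi+e)
                                         (f≗g (suc K) (s≤s z≤n) ≤-refl (i≢1+K ∘ sym)) ⟩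
  sumTo g K + e + g (suc K) ≡⟨ xy∙z≈xz∙y (sumTo g K) e (g (suc K)) ⟩
  sumTo g K + g (suc K) + e ∎
  where
  open ≡-Reasoning
  i≤K : i ≤ K
  i≤K = ≤-pred (≤∧≢⇒< i≤1+K i≢1+K)
  f≗g′ : ∀ k → 1 ≤ k → k ≤ K → k ≢ i → f k ≡ g k
  f≗g′ k 1≤k k≤K = f≗g k 1≤k (m≤n⇒m≤1+n k≤K)

sumTo-exchange : ∀ {f g i j e e′} K → 1 ≤ i → i < j → j ≤ K →
  (∀ k → 1 ≤ k → k ≤ K → k ≢ i → k ≢ j → f k ≡ g k) →
  f i ≡ g i + e → g j ≡ f j + e′ → sumTo f K + e′ ≡ sumTo g K + e
sumTo-exchange zero _ (s≤s _) () _ _ _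
sumTo-exchange {f} {g} {i} {j} {e} {e′} (suc K) 1≤i i<j j≤1+K f≗g fi≡gi+e gj≡fj+e′ with j ≟ suc K
... | yes refl = begin
  sumTo f K + f j + e′   ≡⟨ +-assoc (sumTo f K) (f j) e′ ⟩
  sumTo f K + (f j + e′) ≡⟨ cong₂ _+_ (sumTo-bump K 1≤i (≤-pred i<j) f≗g′ fi≡gi+e) (sym gj≡fj+e′) ⟩
  sumTo g K + e + g j    ≡⟨ xy∙z≈xz∙y (sumTo g K) e (g j) ⟩
  sumTo g K + g j + e    ∎
  where
  open ≡-Reasoning
  f≗g′ : ∀ k → 1 ≤ k → k ≤ K → k ≢ i → f k ≡ g k
  f≗g′ k 1≤k k≤K k≢i = f≗g k 1≤k (m≤n⇒m≤1+n k≤K) k≢i (<⇒≢ (s≤s k≤K))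
... | no j≢1+K = begin
  sumTo f K + f (suc K) + e′ ≡⟨ xy∙z≈xz∙y (sumTo f K) (f (suc K)) e′ ⟩
  sumTo f K + e′ + f (suc K) ≡⟨ cong₂ _+_ (sumTo-exchange K 1≤i i<j j≤K f≗g′ fi≡gi+e gj≡fj+e′) f≡g ⟩
  sumTo g K + e + g (suc K)  ≡⟨ xy∙z≈xz∙y (sumTo g K) e (g (suc K)) ⟩
  sumTo g K + g (suc K) + e  ∎
  where
  open ≡-Reasoning
  j≤K : j ≤ K
  j≤K = ≤-pred (≤∧≢⇒< j≤1+K j≢1+K)
  f≗g′ : ∀ k → 1 ≤ k → k ≤ K → k ≢ i → k ≢ j → f k ≡ g k
  f≗g′ k 1≤k k≤K = f≗g k 1≤k (m≤n⇒m≤1+n k≤K)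
  f≡g : f (suc K) ≡ g (suc K)
  f≡g = f≗g (suc K) (s≤s z≤n) ≤-refl (<⇒≢ (<-≤-trans i<j (m≤n⇒m≤1+n j≤K)) ∘ sym) (j≢1+K ∘ sym)

-- The paper's hypotheses (1) and (2): (n′, a′) are the pair (n, a) of a block after its top
-- or its bottom element has been deleted.
EndDeletion : ℕ × ℕ → ℕ × ℕ → Set
EndDeletion (n′ , a′) (n , a) = (suc n′ ≡ n × suc a′ ≡ a) ⊎ (n′ ≡ n × suc a′ ≡ a)

EndDeletion-size : ∀ {n′ a′ n a} → EndDeletion (n′ , a′) (n , a) → suc a′ ≡ a
EndDeletion-size = Sum.[ proj₂ , proj₂ ]′

-- Block indices start at 1, as in the paper; below, k refers to the block suc k = [k s, (k+1) s).
module _ (s : ℕ) .{{_ : NonZero s}} where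

  k*s+x%s≡x : ∀ k {x} → k * s ≤ x → x < suc k * s → k * s + x % s ≡ x
  k*s+x%s≡x k {x} ks≤x x<ks+s = begin
    k * s + x % s                   ≡⟨ cong (λ y → k * s + y % s) (m∸n+n≡m ks≤x) ⟨
    k * s + (x ∸ k * s + k * s) % s ≡⟨ cong (k * s +_) ([m+kn]%n≡m%n (x ∸ k * s) k s) ⟩
    k * s + (x ∸ k * s) % s         ≡⟨ cong (k * s +_) (m<n⇒m%n≡m x∸ks<s) ⟩
    k * s + (x ∸ k * s)             ≡⟨ m+[n∸m]≡n ks≤x ⟩
    x                               ∎
    where
    open ≡-Reasoning
    x∸ks<s : x ∸ k * s < s
    x∸ks<s = +-cancelʳ-< (k * s) (x ∸ k * s) s (subst (_< s + k * s) (sym (m∸n+n≡m ks≤x)) x<ks+s)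

  ∈-block⁻ : ∀ {S k x} → x ∈ block s S k → x ∈ S × (k ∸ 1) * s ≤ x × x < k * s
  ∈-block⁻ {S} {k} = ∈-filter⁻ (λ x → ((k ∸ 1) * s ≤? x) ×-dec (x <? k * s)) {xs = S}

  ∈-block⁺ : ∀ {S k x} → x ∈ S → (k ∸ 1) * s ≤ x → x < k * s → x ∈ block s S k
  ∈-block⁺ {S} {k} x∈S lb ub = ∈-filter⁺ (λ x → ((k ∸ 1) * s ≤? x) ×-dec (x <? k * s)) {xs = S} x∈S (lb , ub)

  block-unique : ∀ {S} k → Unique S → Unique (block s S k)
  block-unique k = Unique.filter⁺ (λ x → ((k ∸ 1) * s ≤? x) ×-dec (x <? k * s))

  nq<s : ∀ S k → nq s S k < s
  nq<s S k = foldr-⊔-< (>-nonZero⁻¹ s) (All.map⁺ (All.universal (λ x → m%n<n x s) (block s S k)))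

  blockTop : ℕ → List ℕ → ℕ
  blockTop k S = k * s + nq s S (suc k)

  ≤-blockTop : ∀ {S k x} → x ∈ block s S (suc k) → x ≤ blockTop k S
  ≤-blockTop {S} {k} {x} x∈B with ∈-block⁻ {S} {suc k} x∈B
  ... | _ , ks≤x , x<ks+s = subst (_≤ blockTop k S) (k*s+x%s≡x k ks≤x x<ks+s)
    (+-monoʳ-≤ (k * s) (≤-foldr-⊔ (∈-map⁺ (λ y → y % s) x∈B)))

  blockTop∈block : ∀ {S k x} → x ∈ block s S (suc k) → blockTop k S ∈ block s S (suc k)
  blockTop∈block {S} {k} x∈B with ∈-map⁻ (λ y → y % s) (foldr-⊔-∈ (∈-map⁺ (λ y → y % s) x∈B))
  ... | y , y∈B , n≡y%s with ∈-block⁻ {S} {suc k} y∈B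
  ... | _ , ks≤y , y<ks+s =
    subst (_∈ block s S (suc k)) (sym (trans (cong (k * s +_) n≡y%s) (k*s+x%s≡x k ks≤y y<ks+s))) y∈B

  occupied-block-bound : ∀ {S K k x} → All (_< K * s) S → x ∈ block s S (suc k) → suc k ≤ K
  occupied-block-bound {S} {K} {k} S<Ks x∈B with ∈-block⁻ {S} {suc k} x∈B
  ... | x∈S , ks≤x , _ = *-cancelʳ-< s k K (≤-<-trans ks≤x (All.lookup S<Ks x∈S))

  block-convex : ∀ {m S} → InD m s S → ∀ k → Convex (block s S (suc k))
  block-convex {m} {S} (_ , _ , S-range , S-convex) k {x} {y} {z} x∈B z∈B x≤y y≤z
    with ∈-block⁻ {S} {suc k} x∈B | ∈-block⁻ {S} {suc k} z∈B
  ... | x∈S , ks≤x , _ | z∈S , _ , z<ks+s =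
    ∈-block⁺ {S} {suc k} (S-convex (suc k) (s≤s z≤n) k<N x y z x∈S z∈S ks≤x z<ks+s x≤y y≤z)
      (≤-trans ks≤x x≤y) (≤-<-trans y≤z z<ks+s)
    where
    k<N : suc k ≤ N m s
    k<N = occupied-block-bound {S} (All.map proj₂ S-range) x∈B

  record BlockInterval (S : List ℕ) (k : ℕ) : Set where
    field
      lo         : ℕ
      ks≤lo      : k * s ≤ lo
      lo+a≡1+top : lo + aq s S (suc k) ≡ suc (blockTop k S)
      sum≡       : sum (block s S (suc k)) ≡ sum (interval lo (aq s S (suc k)))

  -- An empty block is the empty interval starting at blockTop k S + 1.
  block-interval : ∀ {m S} → InD m s S → ∀ k → BlockInterval S k
  block-interval {m} {S} D k = Sum.[ empty , inhabited ]′ (empty-or-inhabited (block s S (suc k)))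
    where
    empty : block s S (suc k) ≡ [] → BlockInterval S k
    empty B≡[] = record
      { lo         = suc (blockTop k S)
      ; ks≤lo      = ≤-trans (m≤m+n (k * s) _) (n≤1+n _)
      ; lo+a≡1+top = trans (cong (suc (blockTop k S) +_) a≡0) (+-identityʳ _)
      ; sum≡       = trans (cong sum B≡[]) (cong (sum ∘ interval (suc (blockTop k S))) (sym a≡0))
      }
      where
      a≡0 : aq s S (suc k) ≡ 0
      a≡0 = cong length B≡[]
    inhabited : ∃ (_∈ block s S (suc k)) → BlockInterval S k
    inhabited (x , x∈B) =
      let lo , lo∈B , lo+a≡1+top , B↭ =
            convex⇒↭interval (block-unique (suc k) (proj₁ D)) (block-convex D k)
              (blockTop∈block {S} {k} x∈B) (All.tabulate (≤-blockTop {S} {k}))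
      in record { lo = lo ; ks≤lo = proj₁ (proj₂ (∈-block⁻ {S} {suc k} lo∈B))
                ; lo+a≡1+top = lo+a≡1+top ; sum≡ = sum-↭ B↭ }

  block-sum-cong : ∀ {m S T} → InD m s S → InD m s T → ∀ k →
    nq s S (suc k) ≡ nq s T (suc k) → aq s S (suc k) ≡ aq s T (suc k) →
    sum (block s S (suc k)) ≡ sum (block s T (suc k))
  block-sum-cong {m} {S} {T} D D′ k n≡n′ a≡a′ =
    trans sum≡ (trans (cong₂ (λ l a → sum (interval l a)) lo≡lo′ a≡a′) (sym sum′≡))
    where
    open BlockInterval (block-interval D k)
    open BlockInterval (block-interval D′ k)
      renaming (lo to lo′; lo+a≡1+top to lo′+a′≡1+top′; sum≡ to sum′≡) using ()
    lo≡lo′ : lo ≡ lo′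
    lo≡lo′ = +-cancelʳ-≡ (aq s S (suc k)) lo lo′ (begin
      lo + aq s S (suc k)  ≡⟨ lo+a≡1+top ⟩
      suc (blockTop k S)   ≡⟨ cong (λ n → suc (k * s + n)) n≡n′ ⟩
      suc (blockTop k T)   ≡⟨ lo′+a′≡1+top′ ⟨
      lo′ + aq s T (suc k) ≡⟨ cong (lo′ +_) a≡a′ ⟨
      lo′ + aq s S (suc k) ∎)
      where open ≡-Reasoning

  block-shrink : ∀ {m S T} → InD m s S → InD m s T → ∀ k →
    EndDeletion (nq s T (suc k) , aq s T (suc k)) (nq s S (suc k) , aq s S (suc k)) →
    ∃ λ e → k * s ≤ e × e < suc k * s × sum (block s S (suc k)) ≡ sum (block s T (suc k)) + e
  block-shrink {m} {S} {T} D D′ k del = e , ≤-trans ks≤lo lo≤e , e<ks+s , ΣB≡ΣB′+e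
    where
    open BlockInterval (block-interval D k)
    open BlockInterval (block-interval D′ k)
      renaming (lo to lo′; lo+a≡1+top to lo′+a′≡1+top′; sum≡ to sum′≡) using ()
    a′ = aq s T (suc k)
    1+a′≡a : suc a′ ≡ aq s S (suc k)
    1+a′≡a = EndDeletion-size del
    tops : suc (blockTop k T) ≡ blockTop k S ⊎ blockTop k T ≡ blockTop k S
    tops = Sum.map (λ (1+n′≡n , _) → trans (sym (+-suc (k * s) _)) (cong (k * s +_) 1+n′≡n))
                   (λ (n′≡n , _) → cong (k * s +_) n′≡n) del
    shrunk : ∃ λ e → lo ≤ e × e ≤ blockTop k S × sum (interval lo (suc a′)) ≡ sum (interval lo′ a′) + e
    shrunk = interval-shrink (subst (λ a → lo + a ≡ suc (blockTop k S)) (sym 1+a′≡a) lo+a≡1+top)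
                             lo′+a′≡1+top′ tops
    e = proj₁ shrunk
    lo≤e : lo ≤ e
    lo≤e = proj₁ (proj₂ shrunk)
    e<ks+s : e < suc k * s
    e<ks+s = subst (e <_) (+-comm (k * s) s)
      (≤-<-trans (proj₁ (proj₂ (proj₂ shrunk))) (+-monoʳ-< (k * s) (nq<s S (suc k))))
    ΣB≡ΣB′+e : sum (block s S (suc k)) ≡ sum (block s T (suc k)) + e
    ΣB≡ΣB′+e = begin
      sum (block s S (suc k))            ≡⟨ sum≡ ⟩
      sum (interval lo (aq s S (suc k))) ≡⟨ cong (sum ∘ interval lo) 1+a′≡a ⟨
      sum (interval lo (suc a′))         ≡⟨ proj₂ (proj₂ (proj₂ shrunk)) ⟩
      sum (interval lo′ a′) + e          ≡⟨ cong (_+ e) sum′≡ ⟨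
      sum (block s T (suc k)) + e        ∎
      where open ≡-Reasoning

  below : ℕ → List ℕ → List ℕ
  below K = filter (_<? K * s)

  below-suc : ∀ K S → below (suc K) S ↭ below K S ++ block s S (suc K)
  below-suc K [] = ↭-refl
  below-suc K (x ∷ S) = by-cases (x <? K * s) (x <? suc K * s)
    where
    inBlock? = λ y → (K * s ≤? y) ×-dec (y <? suc K * s)
    by-cases : Dec (x < K * s) → Dec (x < suc K * s) →
      below (suc K) (x ∷ S) ↭ below K (x ∷ S) ++ block s (x ∷ S) (suc K)
    by-cases (yes x<Ks) _ =
      subst₂ _↭_ (sym (filter-accept (_<? suc K * s) {xs = S} (<-≤-trans x<Ks (*-monoˡ-≤ s (n≤1+n K)))))
        (sym (cong₂ _++_ (filter-accept (_<? K * s) {xs = S} x<Ks)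
                         (filter-reject inBlock? {xs = S} (λ (Ks≤x , _) → <⇒≱ x<Ks Ks≤x))))
        (↭-prep x (below-suc K S))
    by-cases (no x≮Ks) (yes x<Ks+s) =
      subst₂ _↭_ (sym (filter-accept (_<? suc K * s) {xs = S} x<Ks+s))
        (sym (cong₂ _++_ (filter-reject (_<? K * s) {xs = S} x≮Ks)
                         (filter-accept inBlock? {xs = S} (≮⇒≥ x≮Ks , x<Ks+s))))
        (↭-trans (↭-prep x (below-suc K S)) (↭-sym (shift x (below K S) (block s S (suc K)))))
    by-cases (no x≮Ks) (no x≮Ks+s) =
      subst₂ _↭_ (sym (filter-reject (_<? suc K * s) {xs = S} x≮Ks+s))
        (sym (cong₂ _++_ (filter-reject (_<? K * s) {xs = S} x≮Ks)
                         (filter-reject inBlock? {xs = S} (x≮Ks+s ∘ proj₂))))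
        (below-suc K S)

  module Additive (F : List ℕ → ℕ) (F-↭ : ∀ {xs ys} → xs ↭ ys → F xs ≡ F ys)
                  (F-++ : ∀ xs ys → F (xs ++ ys) ≡ F xs + F ys) (F-[] : F [] ≡ 0) where

    below-additive : ∀ K S → F (below K S) ≡ sumTo (λ k → F (block s S k)) K
    below-additive zero    S = trans (cong F (filter-none (_<? 0) (All.universal (λ _ ()) S))) F-[]
    below-additive (suc K) S =
      trans (F-↭ (below-suc K S)) (trans (F-++ _ _) (cong (_+ F (block s S (suc K))) (below-additive K S)))

    block-additive : ∀ K S → All (_< K * s) S → F S ≡ sumTo (λ k → F (block s S k)) K
    block-additive K S S<Ks = trans (cong F (sym (filter-all (_<? K * s) S<Ks))) (below-additive K S)

    additive-exchange : ∀ K {S S′ i j e e′} → All (_< K * s) S → All (_< K * s) S′ →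
      1 ≤ i → i < j → j ≤ K →
      (∀ k → 1 ≤ k → k ≤ K → k ≢ i → k ≢ j → F (block s S k) ≡ F (block s S′ k)) →
      F (block s S i) ≡ F (block s S′ i) + e → F (block s S′ j) ≡ F (block s S j) + e′ →
      F S + e′ ≡ F S′ + e
    additive-exchange K {S} {S′} {e = e} {e′} S<Ks S′<Ks 1≤i i<j j≤K agree at-i at-j =
      subst₂ (λ x y → x + e′ ≡ y + e) (sym (block-additive K S S<Ks)) (sym (block-additive K S′ S′<Ks))
        (sumTo-exchange K 1≤i i<j j≤K agree at-i at-j)

  open Additive length ↭-length (λ xs _ → length-++ xs) refl public
    using () renaming (additive-exchange to length-exchange)
  open Additive sum sum-↭ sum-++ refl public
    using () renaming (additive-exchange to sum-exchange)

<-of-+-exchange : ∀ {a b e e′} → a + e′ ≡ b + e → e < e′ → a < b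
<-of-+-exchange {a} {b} {e} {e′} a+e′≡b+e e<e′ =
  +-cancelʳ-< e′ a b (subst (_< b + e′) (sym a+e′≡b+e) (+-monoʳ-< b e<e′))

f-mono-sum : ∀ {S S′} → length S ≡ length S′ → sum S < sum S′ → f S ℤ.< f S′
f-mono-sum {S} {S′} |S|≡|S′| ΣS<ΣS′ =
  subst (λ l → f S ℤ.< (ℤ.+ sum S′) ℤ.- (ℤ.+ ((l * (l ∸ 1)) / 2))) |S|≡|S′|
    (ℤ.+-monoˡ-< (ℤ.- (ℤ.+ ((length S * (length S ∸ 1)) / 2))) (ℤ.+<+ ΣS<ΣS′))

corollary5p8 : (s m : ℕ) .{{_ : NonZero s}} → 1 ≤ m →
    (S S' : List ℕ) → InD m s S → InD m s S' →
    (t : ℕ) → IsT m s S t → IsT m s S' t →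
    (i j : ℕ) → 1 ≤ i → i < j →
    ((suc (nq s S' i) ≡ nq s S i × suc (aq s S' i) ≡ aq s S i)
      ⊎ (nq s S' i ≡ nq s S i × suc (aq s S' i) ≡ aq s S i)) →
    ((nq s S' j ≡ suc (nq s S j) × aq s S' j ≡ suc (aq s S j))
      ⊎ (nq s S' j ≡ nq s S j × aq s S' j ≡ suc (aq s S j))) →
    (∀ k → 1 ≤ k → k ≤ t * m → k ≢ i → k ≢ j →
      nq s S k ≡ nq s S' k × aq s S k ≡ aq s S' k) →
    f S ℤ.< f S'
corollary5p8 s m _ S S′ D D′ t (_ , S<Ks , _) (_ , S′<Ks , _) (suc i) (suc j) 1≤i (s≤s i<j)
             shrink-i grow-j agree =
  f-mono-sum {S} {S′} (+-cancelʳ-≡ 1 _ _ |S|+1≡|S′|+1) (<-of-+-exchange ΣS+e′≡ΣS′+e e<e′)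
  where
  K = t * m
  shrink-j = Sum.map (Prod.map sym sym) (Prod.map sym sym) grow-j
  1+j≤K : suc j ≤ K
  1+j≤K = occupied-block-bound s {S′} {K} {j} S′<Ks
            (proj₂ (inhabited-of-length (sym (EndDeletion-size shrink-j))))
  block-i = block-shrink s D D′ i shrink-i
  block-j = block-shrink s D′ D j shrink-j
  e = proj₁ block-i
  e′ = proj₁ block-j
  e<e′ : e < e′
  e<e′ = <-≤-trans (proj₁ (proj₂ (proj₂ block-i))) (≤-trans (*-monoˡ-≤ s i<j) (proj₁ (proj₂ block-j)))
  |S|+1≡|S′|+1 : length S + 1 ≡ length S′ + 1
  |S|+1≡|S′|+1 = length-exchange s K S<Ks S′<Ks 1≤i (s≤s i<j) 1+j≤K
    (λ k 1≤k k≤K k≢i k≢j → proj₂ (agree k 1≤k k≤K k≢i k≢j))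
    (trans (sym (EndDeletion-size shrink-i)) (+-comm 1 _))
    (trans (sym (EndDeletion-size shrink-j)) (+-comm 1 _))
  agree-sum : ∀ k → 1 ≤ k → k ≤ K → k ≢ suc i → k ≢ suc j → sum (block s S k) ≡ sum (block s S′ k)
  agree-sum (suc k) 1≤k k≤K k≢i k≢j =
    let n≡n′ , a≡a′ = agree (suc k) 1≤k k≤K k≢i k≢j in block-sum-cong s D D′ k n≡n′ a≡a′
  ΣS+e′≡ΣS′+e : sum S + e′ ≡ sum S′ + e
  ΣS+e′≡ΣS′+e = sum-exchange s K S<Ks S′<Ks 1≤i (s≤s i<j) 1+j≤K agree-sum
    (proj₂ (proj₂ (proj₂ block-i))) (proj₂ (proj₂ (proj₂ block-j)))
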